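{- Let $\mathcal M$ be a multiset with underlying set $X$ and let $A_1,\dots,A_k$, $k\ge2$, be a partition of $\mathcal M$ (submultisets whose multiset union is $\mathcal M$). Let $G$ be a graph with vertex set $\{A_1,\dots,A_k\}$ such that every edge $\{A_i,A_j\}$, $i\ne j$, of $G$ satisfies $A_i\cap A_j\neq\emptyset$. Then $\Delta(\mathcal M)\ge k-c$, where $c$ is the number of connected components of $G$.
   Context: For a multiset $\mathcal M$ with underlying set $X$, $\mathcal M(x)\ge1$ denotes the multiplicity of $x\in X$ and $\Delta(\mathcal M)=\sum_{x\in X}(\mathcal M(x)-1)$. -}

module Defs where

open import Data.Nat using (ℕ; zero; suc; _+_; _∸_; _≤_)
open import Data.Fin using (Fin; zero; suc)
open import Data.Product using (Σ; ∃; _×_; _,_)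
open import Relation.Binary.PropositionalEquality using (_≡_)
open import Relation.Nullary using (¬_)
open import Relation.Binary.Construct.Closure.ReflexiveTransitive using (Star)
open import Function.Definitions using (Surjective)

sumFin : (n : ℕ) → (Fin n → ℕ) → ℕ
sumFin zero    f = 0
sumFin (suc n) f = f zero + sumFin n (λ i → f (suc i))

-- A (finite) multiset with underlying set X = Fin n:
-- every element of X has multiplicity ≥ 1.
record Multiset : Set where
  field
    size   : ℕ
    mult   : Fin size → ℕ
    mult≥1 : ∀ x → 1 ≤ mult x
open Multiset public

Δ : Multiset → ℕ
Δ M = sumFin (size M) (λ x → mult M x ∸ 1)

-- A family of k submultisets of M (given by multiplicity functions on X)
-- whose multiset union (sum of multiplicities) is M, each part nonempty.
record IsPartition (M : Multiset) (k : ℕ) (A : Fin k → Fin (size M) → ℕ) : Set where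
  field
    union    : ∀ x → sumFin k (λ i → A i x) ≡ mult M x
    nonempty : ∀ i → ∃ λ x → 1 ≤ A i x
open IsPartition public

-- Multiset intersection A ∩ B (pointwise min) is nonempty
IntersectNonempty : {n : ℕ} → (Fin n → ℕ) → (Fin n → ℕ) → Set
IntersectNonempty {n} a b = ∃ λ (x : Fin n) → (1 ≤ a x) × (1 ≤ b x)

record Graph (k : ℕ) : Set₁ where
  field
    Adj    : Fin k → Fin k → Set
    sym    : ∀ {i j} → Adj i j → Adj j i
    irrefl : ∀ {i} → ¬ Adj i i
open Graph public

Connected : {k : ℕ} → Graph k → Fin k → Fin k → Set
Connected G = Star (Adj G)

-- G has exactly c connected components: there is a surjective labelling
-- of vertices by Fin c identifying exactly the connected vertices.
HasComponents : {k : ℕ} → Graph k → ℕ → Set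
HasComponents {k} G c =
  Σ (Fin k → Fin c) λ comp →
    Surjective _≡_ _≡_ comp ×
    (∀ i j → (comp i ≡ comp j → Connected G i j) × (Connected G i j → comp i ≡ comp j))

-- Start from the discrete labelling of the parts A₁ … A_k (k classes) and, for each x ∈ X,
-- merge the classes of all parts containing x. Merging the parts that contain x costs at most
-- (Σᵢ Aᵢ(x)) − 1 = M(x) − 1 merges, each of which loses at most one class, so at least
-- k − Δ(M) classes survive. Adjacent parts of G share an element, hence end up in one class;
-- so every class is a union of components of G, and there are at most c classes.
module Submission where

open import Defs hiding (sym)
open import Data.Nat using (ℕ; zero; suc; _+_; _∸_; _≤_; s≤s)
open import Data.Nat.Properties
  using (≤-refl; ≤-trans; ≤-reflexive; n>0⇒n≢0; m≤m+n; m≤n+m; +-comm; +-assoc; +-monoˡ-≤; +-monoʳ-≤; module ≤-Reasoning)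
open import Data.Fin using (Fin; zero; suc; punchIn; punchOut; _≟_)
open import Data.Fin.Properties using (punchOut-cong; punchOut-punchIn; punchInᵢ≢i; injective⇒≤)
open import Data.Product using (Σ; _×_; _,_; proj₁; proj₂)
open import Data.Empty using (⊥-elim)
open import Function using (_∘_; id)
open import Function.Definitions using (StrictlySurjective; Injective)
open import Relation.Binary.PropositionalEquality using (_≡_; _≢_; refl; sym; trans; cong; cong₂)
open import Relation.Nullary using (yes; no)
open import Relation.Binary.Construct.Closure.ReflexiveTransitive using (ε; _◅_)

sumFin-cong : ∀ n {f g : Fin n → ℕ} → (∀ i → f i ≡ g i) → sumFin n f ≡ sumFin n g
sumFin-cong zero    f≗g = refl
sumFin-cong (suc n) f≗g = cong₂ _+_ (f≗g zero) (sumFin-cong n (f≗g ∘ suc))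

collapse : ∀ {m} {u v : Fin (suc m)} → u ≢ v →
  Σ (Fin (suc m) → Fin m) λ f → StrictlySurjective _≡_ f × f u ≡ f v
collapse {m} {u} {v} u≢v = f , f-surjective , trans f-u (sym (f-avoiding v u≢v))
  where
  f : Fin (suc m) → Fin m
  f y with u ≟ y
  ... | yes _   = punchOut u≢v
  ... | no u≢y  = punchOut u≢y

  f-avoiding : ∀ y (u≢y : u ≢ y) → f y ≡ punchOut u≢y
  f-avoiding y u≢y with u ≟ y
  ... | yes u≡y = ⊥-elim (u≢y u≡y)
  ... | no _    = punchOut-cong u refl

  f-u : f u ≡ punchOut u≢v
  f-u with u ≟ u
  ... | yes _   = refl
  ... | no u≢u  = ⊥-elim (u≢u refl)

  f-surjective : StrictlySurjective _≡_ f
  f-surjective z = punchIn u z , trans (f-avoiding _ (punchInᵢ≢i u z ∘ sym)) (punchOut-punchIn u)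

record Labelling (k : ℕ) : Set where
  constructor labelling
  field
    classes          : ℕ
    label            : Fin k → Fin classes
    label-surjective : StrictlySurjective _≡_ label
open Labelling

discrete : ∀ k → Labelling k
discrete k = labelling k id (λ i → i , refl)

_≼_ : ∀ {k} → Labelling k → Labelling k → Set
S ≼ T = ∀ i j → label S i ≡ label S j → label T i ≡ label T j

≼-refl : ∀ {k} {S : Labelling k} → S ≼ S
≼-refl i j same = same

≼-trans : ∀ {k} {S T U : Labelling k} → S ≼ T → T ≼ U → S ≼ U
≼-trans S≼T T≼U i j = T≼U i j ∘ S≼T i j

Stable : ∀ {k} → (Labelling k → Set) → Set
Stable P = ∀ T U → T ≼ U → P T → P U

record Coarsening {k} (S : Labelling k) (cost : ℕ) (P : Labelling k → Set) : Set where
  constructor coarsening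
  field
    target  : Labelling k
    coarser : S ≼ target
    holds   : P target
    bounded : classes S ≤ classes target + cost
open Coarsening

adjust : ∀ {k} {S : Labelling k} {c c′} {P Q : Labelling k → Set} →
  Coarsening S c P → c ≤ c′ → (∀ T → P T → Q T) → Coarsening S c′ Q
adjust (coarsening T S≼T pT bound) c≤c′ P⇒Q =
  coarsening T S≼T (P⇒Q T pT) (≤-trans bound (+-monoʳ-≤ (classes T) c≤c′))

compose : ∀ {k} {S : Labelling k} {c₁ c₂} {P Q : Labelling k → Set} →
  Stable P → (C : Coarsening S c₁ P) → Coarsening (target C) c₂ Q →
  Coarsening S (c₁ + c₂) (λ U → P U × Q U)
compose {S = S} {c₁} {c₂} stable (coarsening T S≼T pT S≤T) (coarsening U T≼U qU T≤U) =
  coarsening U (≼-trans {S = S} {T} {U} S≼T T≼U) (stable T U T≼U pT , qU) bound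
  where
  open ≤-Reasoning
  bound : classes S ≤ classes U + (c₁ + c₂)
  bound = begin
    classes S                ≤⟨ S≤T ⟩
    classes T + c₁           ≤⟨ +-monoˡ-≤ c₁ T≤U ⟩
    classes U + c₂ + c₁      ≡⟨ +-assoc (classes U) c₂ c₁ ⟩
    classes U + (c₂ + c₁)    ≡⟨ cong (classes U +_) (+-comm c₂ c₁) ⟩
    classes U + (c₁ + c₂)    ∎

merge : ∀ {k} (S : Labelling k) (a b : Fin k) → Coarsening S 1 (λ T → label T a ≡ label T b)
merge S a b with label S a ≟ label S b
... | yes same = coarsening S (≼-refl {S = S}) same (m≤m+n (classes S) 1)
merge (labelling zero ℓ _) a b | no _ with ℓ a
... | ()
merge (labelling (suc m) ℓ ℓ-surjective) a b | no ℓa≢ℓb with collapse ℓa≢ℓb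
... | f , f-surjective , fa≡fb =
  coarsening (labelling m (f ∘ ℓ) f∘ℓ-surjective) (λ i j → cong f {ℓ i}) fa≡fb (≤-reflexive (+-comm 1 m))
  where
  f∘ℓ-surjective : StrictlySurjective _≡_ (f ∘ ℓ)
  f∘ℓ-surjective z with f-surjective z
  ... | y , fy≡z with ℓ-surjective y
  ...   | i , ℓi≡y = i , trans (cong f ℓi≡y) fy≡z

JoinedTo : ∀ {k n} → (Fin n → Fin k) → (Fin n → ℕ) → Fin k → Labelling k → Set
JoinedTo p w a T = ∀ t → 1 ≤ w t → label T (p t) ≡ label T a

-- Every t in the support of w costs at most one merge, and contributes at least 1 to the sum.
joinTo : ∀ {k} n (p : Fin n → Fin k) (w : Fin n → ℕ) (a : Fin k) (S : Labelling k) →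
  Coarsening S (sumFin n w) (JoinedTo p w a)
joinTo zero p w a S = coarsening S (≼-refl {S = S}) (λ ()) (m≤m+n (classes S) 0)
joinTo (suc n) p w a S with w zero in w₀
... | zero = adjust (joinTo n (p ∘ suc) (w ∘ suc) a S) ≤-refl skip-head
  where
  skip-head : ∀ T → JoinedTo (p ∘ suc) (w ∘ suc) a T → JoinedTo p w a T
  skip-head _ joined zero    w₀>0 = ⊥-elim (n>0⇒n≢0 w₀>0 w₀)
  skip-head _ joined (suc t) wₜ>0 = joined t wₜ>0
... | suc v = adjust
  (compose (λ T U T≼U → T≼U a (p zero)) (merge S a (p zero)) (joinTo n (p ∘ suc) (w ∘ suc) a _))
  (s≤s (m≤n+m _ v)) join-head
  where
  join-head : ∀ T → label T a ≡ label T (p zero) × JoinedTo (p ∘ suc) (w ∘ suc) a T → JoinedTo p w a T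
  join-head _ (head , joined) zero    _    = sym head
  join-head _ (head , joined) (suc t) wₜ>0 = joined t wₜ>0

Joined : ∀ {k n} → (Fin n → Fin k) → (Fin n → ℕ) → Labelling k → Set
Joined p w T = ∀ t t′ → 1 ≤ w t → 1 ≤ w t′ → label T (p t) ≡ label T (p t′)

joined-stable : ∀ {k n} (p : Fin n → Fin k) (w : Fin n → ℕ) → Stable (Joined p w)
joined-stable p w T U T≼U joined t t′ wₜ>0 wₜ′>0 = T≼U (p t) (p t′) (joined t t′ wₜ>0 wₜ′>0)

-- The first t in the support serves as the anchor for joinTo, which saves one merge.
joinSupport : ∀ {k} n (p : Fin n → Fin k) (w : Fin n → ℕ) (S : Labelling k) →
  Coarsening S (sumFin n w ∸ 1) (Joined p w)
joinSupport zero p w S = coarsening S (≼-refl {S = S}) (λ ()) (m≤m+n (classes S) 0)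
joinSupport (suc n) p w S with w zero in w₀
... | zero = adjust (joinSupport n (p ∘ suc) (w ∘ suc) S) ≤-refl skip-head
  where
  skip-head : ∀ T → Joined (p ∘ suc) (w ∘ suc) T → Joined p w T
  skip-head _ joined zero    _       w₀>0 _    = ⊥-elim (n>0⇒n≢0 w₀>0 w₀)
  skip-head _ joined (suc t) zero    _    w₀>0 = ⊥-elim (n>0⇒n≢0 w₀>0 w₀)
  skip-head _ joined (suc t) (suc t′) wₜ>0 wₜ′>0 = joined t t′ wₜ>0 wₜ′>0
... | suc v = adjust (joinTo n (p ∘ suc) (w ∘ suc) (p zero) S) (m≤n+m _ v) joined-via-head
  where
  joined-via-head : ∀ T → JoinedTo (p ∘ suc) (w ∘ suc) (p zero) T → Joined p w T
  joined-via-head T joined t t′ wₜ>0 wₜ′>0 = trans (to-head t wₜ>0) (sym (to-head t′ wₜ′>0))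
    where
    to-head : ∀ t → 1 ≤ w t → label T (p t) ≡ label T (p zero)
    to-head zero    _    = refl
    to-head (suc t) wₜ>0 = joined t wₜ>0

JoinedAll : ∀ {k s} → (Fin s → Fin k → ℕ) → Labelling k → Set
JoinedAll e T = ∀ x → Joined id (e x) T

joinAll : ∀ {k} s (e : Fin s → Fin k → ℕ) (S : Labelling k) →
  Coarsening S (sumFin s (λ x → sumFin k (e x) ∸ 1)) (JoinedAll e)
joinAll zero e S = coarsening S (≼-refl {S = S}) (λ ()) (m≤m+n (classes S) 0)
joinAll {k} (suc s) e S = adjust
  (compose (joined-stable id (e zero)) (joinSupport k id (e zero) S) (joinAll s (e ∘ suc) _))
  ≤-refl cases
  where
  cases : ∀ T → Joined id (e zero) T × JoinedAll (e ∘ suc) T → JoinedAll e T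
  cases _ (head , _)    zero    = head
  cases _ (_ , joined)  (suc x) = joined x

label-connected : ∀ {k} (G : Graph k) (T : Labelling k) →
  (∀ i j → Adj G i j → label T i ≡ label T j) →
  ∀ {i j} → Connected G i j → label T i ≡ label T j
label-connected G T edge ε                      = refl
label-connected G T edge (_◅_ {i} {j} i~j path) = trans (edge i j i~j) (label-connected G T edge path)

classes≤components : ∀ {k} (G : Graph k) (T : Labelling k) →
  (∀ i j → Adj G i j → label T i ≡ label T j) →
  ∀ {c} → HasComponents G c → classes T ≤ c
classes≤components G T edge (comp , _ , comp⇔connected) = injective⇒≤ comp∘rep-injective
  where
  rep : Fin (classes T) → Fin _
  rep y = proj₁ (label-surjective T y)

  comp∘rep-injective : Injective _≡_ _≡_ (comp ∘ rep)
  comp∘rep-injective {y} {y′} same-component = begin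
    y                ≡⟨ sym (proj₂ (label-surjective T y)) ⟩
    label T (rep y)  ≡⟨ label-connected G T edge (proj₁ (comp⇔connected (rep y) (rep y′)) same-component) ⟩
    label T (rep y′) ≡⟨ proj₂ (label-surjective T y′) ⟩
    y′               ∎
    where open Relation.Binary.PropositionalEquality.≡-Reasoning

Δ-partition : ∀ {M k A} → IsPartition M k A → sumFin (size M) (λ x → sumFin k (λ i → A i x) ∸ 1) ≡ Δ M
Δ-partition {M} P = sumFin-cong (size M) (λ x → cong (_∸ 1) (union P x))

lemma7 : (M : Multiset) (k : ℕ) → 2 ≤ k →
    (A : Fin k → Fin (size M) → ℕ) → IsPartition M k A →
    (G : Graph k) → (∀ i j → Adj G i j → IntersectNonempty (A i) (A j)) →
    (c : ℕ) → HasComponents G c →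
    k ≤ Δ M + c
lemma7 M k _ A P G adj c components = begin
  k                              ≤⟨ bounded merged ⟩
  classes T + cost               ≡⟨ cong (classes T +_) (Δ-partition P) ⟩
  classes T + Δ M                ≤⟨ +-monoˡ-≤ (Δ M) (classes≤components G T edge components) ⟩
  c + Δ M                        ≡⟨ +-comm c (Δ M) ⟩
  Δ M + c                        ∎
  where
  open ≤-Reasoning
  cost : ℕ
  cost = sumFin (size M) (λ x → sumFin k (λ i → A i x) ∸ 1)

  merged : Coarsening (discrete k) cost (JoinedAll (λ x i → A i x))
  merged = joinAll (size M) (λ x i → A i x) (discrete k)

  T : Labelling k
  T = target merged

  edge : ∀ i j → Adj G i j → label T i ≡ label T j
  edge i j i~j with adj i j i~j
  ... | x , x∈Aᵢ , x∈Aⱼ = holds merged x i j x∈Aᵢ x∈Aⱼ
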